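{- Let $\alpha,\beta,\gamma,\delta$ be complex numbers and let $n\ge 1$. Let $(a_{i,j})_{i\ge 0,\,j\ge 0}$ be a tableau of complex numbers satisfying \[\delta a_{i,j}=\alpha a_{i-1,j}+\beta a_{i-1,j-1}+\gamma a_{i,j-1}\quad\text{for all } i\ge 1,\ j\ge 1,\] together with the boundary conditions \[\beta a_{i,0}+\gamma a_{i+1,0}=0\quad\text{and}\quad \delta a_{i+1,n+1}-\alpha a_{i,n+1}=0\qquad\text{for all }1\le i\le n-1.\] Let $R=(a_{i,j})_{1\le i,j\le n}$ and, for $e\ge 1$, write $R^e=(a^{(e)}_{i,j})_{1\le i,j\le n}$. Define sequences $(\delta_e),(\alpha_e),(\beta_e),(\gamma_e)_{e\ge1}$ each satisfying the recurrence \[x_{e+1}=(\beta+\delta)x_e-(\beta\delta+\alpha\gamma)x_{e-1}\quad(e\ge 2),\] with initial values $\delta_1=\delta,\ \delta_2=\delta^2-\alpha\gamma$; $\alpha_1=\alpha,\ \alpha_2=\alpha(\delta+\beta)$; $\beta_1=\beta,\ \beta_2=\beta^2-\alpha\gamma$; $\gamma_1=\gamma,\ \gamma_2=\gamma(\beta+\delta)$. Then for every $e\ge 1$ and all $2\le i,j\le n$, \[\delta_e a^{(e)}_{i,j}=\alpha_e a^{(e)}_{i-1,j}+\beta_e a^{(e)}_{i-1,j-1}+\gamma_e a^{(e)}_{i,j-1}.\] -}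

module Defs where

open import Level using (Level)
open import Data.Nat using (ℕ; zero; suc)
open import Data.Product using (Σ; _×_)
open import Relation.Nullary using (¬_)
open import Algebra.Bundles using (CommutativeRing)

module _ {c ℓ : Level} (K : CommutativeRing c ℓ) where
  open CommutativeRing K

  embℕ : ℕ → Carrier
  embℕ zero    = 0#
  embℕ (suc n) = 1# + embℕ n

  record IsCharZeroField : Set (c Level.⊔ ℓ) where
    field
      nontrivial : ¬ (1# ≈ 0#)
      inverse    : ∀ x → ¬ (x ≈ 0#) → Σ Carrier λ y → x * y ≈ 1#
      charZero   : ∀ n → ¬ (embℕ (suc n) ≈ 0#)

  -- infinite tableaux / matrices, indexed by ℕ × ℕ (only entries 1..n are used for matrices)
  Tableau : Set c
  Tableau = ℕ → ℕ → Carrier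

  sum1 : ℕ → (ℕ → Carrier) → Carrier
  sum1 zero    f = 0#
  sum1 (suc m) f = sum1 m f + f (suc m)

  matMul : ℕ → Tableau → Tableau → Tableau
  matMul n A B i j = sum1 n (λ k → A i k * B k j)

  matPow : ℕ → Tableau → ℕ → Tableau
  matPow n a zero    i j = a i j  -- unused junk (R^0 never used; e ≥ 1)
  matPow n a (suc zero) i j = a i j
  matPow n a (suc (suc e)) = matMul n (matPow n a (suc e)) a

  recSeq : (α β γ δ x1 x2 : Carrier) → ℕ → Carrier
  recSeq α β γ δ x1 x2 zero = 0#
  recSeq α β γ δ x1 x2 (suc zero) = x1
  recSeq α β γ δ x1 x2 (suc (suc zero)) = x2
  recSeq α β γ δ x1 x2 (suc (suc (suc e))) =
    ((β + δ) * recSeq α β γ δ x1 x2 (suc (suc e)))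
      - ((β * δ + α * γ) * recSeq α β γ δ x1 x2 (suc e))

module Submission where

-- For X = R^(e+1) we track the four-term relation
--   D X(i,k) + Ā X(i-1,k) = G X(i,k-1) + B X(i-1,k-1)   (column 0 read as 0),
-- together with G X(i,n) + B X(i-1,n) = 0.  Multiplying by R on the right and summing by parts
-- against the tableau recurrence and the two boundary conditions shows that X R satisfies the same
-- relation with both (D,G) and (Ā,B) replaced by their images under M = [[δ,-α],[γ,β]].  So the
-- coefficients are orbits of M, and by Cayley-Hamilton each obeys x(e+1) = tr M x(e) - det M x(e-1),
-- where tr M = β + δ and det M = βδ + αγ.  Matching initial values identifies them with δ_e, -α_e, γ_e, β_e.

open import Defs
open import Level using (Level)
open import Data.Nat as ℕ using (ℕ; zero; suc; _≤_; _∸_; z≤n; s≤s; s≤s⁻¹)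
import Data.Nat.Properties as ℕₚ
open import Algebra.Bundles using (CommutativeRing)
open import Data.Integer.Base as ℤ using (ℤ; +_; -[1+_]; _⊖_; sign; ∣_∣; _◃_)
import Data.Integer.Properties as ℤₚ
open import Data.Sign.Base as Sign using (Sign)
open import Data.Maybe.Base using (Maybe; just; nothing)
open import Data.Product.Base using (_×_; _,_; proj₁; proj₂)
open import Relation.Nullary.Decidable.Core using (yes; no)
import Relation.Binary.PropositionalEquality as ≡
open import Algebra.Solver.Ring.AlmostCommutativeRing
  using (AlmostCommutativeRing; fromCommutativeRing; _-Raw-AlmostCommutative⟶_)

-- The ring solver needs coefficients with decidable equality: ℤ, through its canonical map into K.
module IntegerCoefficients {c ℓ : Level} (K : CommutativeRing c ℓ) where
  open CommutativeRing K
  open import Algebra.Properties.Ring ring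
    using (-0#≈0#; -‿involutive; -‿distribˡ-*; -‿distribʳ-*; -‿+-comm)
  open import Algebra.Properties.Semiring.Mult semiring using (×-homo-+; ×1-homo-*)
    renaming (_×_ to _·_)
  open import Relation.Binary.Reasoning.Setoid setoid

  signed : Sign → Carrier → Carrier
  signed Sign.+ x = x
  signed Sign.- x = - x

  signed-cong : ∀ s {x y} → x ≈ y → signed s x ≈ signed s y
  signed-cong Sign.+ x≈y = x≈y
  signed-cong Sign.- x≈y = -‿cong x≈y

  signed-* : ∀ s t x y → signed (s Sign.* t) (x * y) ≈ signed s x * signed t y
  signed-* Sign.+ Sign.+ x y = refl
  signed-* Sign.+ Sign.- x y = -‿distribʳ-* x y
  signed-* Sign.- Sign.+ x y = -‿distribˡ-* x y
  signed-* Sign.- Sign.- x y = begin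
    x * y         ≈⟨ -‿involutive (x * y) ⟨
    - - (x * y)   ≈⟨ -‿cong (-‿distribˡ-* x y) ⟩
    - (- x * y)   ≈⟨ -‿distribʳ-* (- x) y ⟩
    - x * - y     ∎

  fromℤ : ℤ → Carrier
  fromℤ i = signed (sign i) (∣ i ∣ · 1#)

  fromℤ-◃ : ∀ s n → fromℤ (s ◃ n) ≈ signed s (n · 1#)
  fromℤ-◃ Sign.+ zero    = refl
  fromℤ-◃ Sign.- zero    = sym -0#≈0#
  fromℤ-◃ Sign.+ (suc n) = refl
  fromℤ-◃ Sign.- (suc n) = refl

  fromℤ-* : ∀ i j → fromℤ (i ℤ.* j) ≈ fromℤ i * fromℤ j
  fromℤ-* i j = begin
    fromℤ (sign i Sign.* sign j ◃ ∣ i ∣ ℕ.* ∣ j ∣)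
      ≈⟨ fromℤ-◃ (sign i Sign.* sign j) (∣ i ∣ ℕ.* ∣ j ∣) ⟩
    signed (sign i Sign.* sign j) ((∣ i ∣ ℕ.* ∣ j ∣) · 1#)
      ≈⟨ signed-cong (sign i Sign.* sign j) (×1-homo-* ∣ i ∣ ∣ j ∣) ⟩
    signed (sign i Sign.* sign j) ((∣ i ∣ · 1#) * (∣ j ∣ · 1#))
      ≈⟨ signed-* (sign i) (sign j) _ _ ⟩
    fromℤ i * fromℤ j ∎

  fromℤ-⊖ : ∀ m n → fromℤ (m ⊖ n) ≈ m · 1# - n · 1#
  fromℤ-⊖ m       zero    = sym (trans (+-congˡ -0#≈0#) (+-identityʳ _))
  fromℤ-⊖ zero    (suc n) = sym (+-identityˡ _)
  fromℤ-⊖ (suc m) (suc n) = begin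
    fromℤ (suc m ⊖ suc n)               ≡⟨ ≡.cong fromℤ (ℤₚ.[1+m]⊖[1+n]≡m⊖n m n) ⟩
    fromℤ (m ⊖ n)                       ≈⟨ fromℤ-⊖ m n ⟩
    x - y                               ≈⟨ +-identityˡ (x - y) ⟨
    0# + (x - y)                        ≈⟨ +-congʳ (-‿inverseʳ 1#) ⟨
    (1# - 1#) + (x - y)                 ≈⟨ +-assoc 1# (- 1#) (x - y) ⟩
    1# + (- 1# + (x - y))               ≈⟨ +-congˡ (+-assoc (- 1#) x (- y)) ⟨
    1# + ((- 1# + x) - y)               ≈⟨ +-congˡ (+-congʳ (+-comm (- 1#) x)) ⟩
    1# + ((x - 1#) - y)                 ≈⟨ +-congˡ (+-assoc x (- 1#) (- y)) ⟩
    1# + (x + (- 1# - y))               ≈⟨ +-assoc 1# x (- 1# - y) ⟨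
    (1# + x) + (- 1# - y)               ≈⟨ +-congˡ (-‿+-comm 1# y) ⟩
    (1# + x) - (1# + y)                 ∎
    where x = m · 1#; y = n · 1#

  fromℤ-+ : ∀ i j → fromℤ (i ℤ.+ j) ≈ fromℤ i + fromℤ j
  fromℤ-+ (+ m)    (+ n)    = ×-homo-+ 1# m n
  fromℤ-+ (+ m)    -[1+ n ] = fromℤ-⊖ m (suc n)
  fromℤ-+ -[1+ m ] (+ n)    = trans (fromℤ-⊖ n (suc m)) (+-comm _ _)
  fromℤ-+ -[1+ m ] -[1+ n ] = begin
    - (suc (suc (m ℕ.+ n)) · 1#)  ≡⟨ ≡.cong (λ k → - (suc k · 1#)) (ℕₚ.+-suc m n) ⟨
    - ((suc m ℕ.+ suc n) · 1#)    ≈⟨ -‿cong (×-homo-+ 1# (suc m) (suc n)) ⟩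
    - (suc m · 1# + suc n · 1#)          ≈⟨ -‿+-comm (suc m · 1#) (suc n · 1#) ⟨
    - (suc m · 1#) - suc n · 1#          ∎

  fromℤ-neg : ∀ i → fromℤ (ℤ.- i) ≈ - fromℤ i
  fromℤ-neg (+ zero)  = sym -0#≈0#
  fromℤ-neg (+ suc n) = refl
  fromℤ-neg -[1+ n ]  = sym (-‿involutive _)

  private
    K′ : AlmostCommutativeRing c ℓ
    K′ = fromCommutativeRing K

    fromℤ-morphism : ℤ.+-*-rawRing -Raw-AlmostCommutative⟶ K′
    fromℤ-morphism = record
      { ⟦_⟧ = fromℤ ; +-homo = fromℤ-+ ; *-homo = fromℤ-* ; -‿homo = fromℤ-neg
      ; 0-homo = refl ; 1-homo = +-identityʳ 1# }

    fromℤ-≟ : ∀ i j → Maybe (fromℤ i ≈ fromℤ j)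
    fromℤ-≟ i j with i ℤₚ.≟ j
    ... | yes ≡.refl = just refl
    ... | no _       = nothing

  open import Algebra.Solver.Ring ℤ.+-*-rawRing K′ fromℤ-morphism fromℤ-≟ public

module Sums {c ℓ : Level} (K : CommutativeRing c ℓ) where
  open CommutativeRing K
  open IntegerCoefficients K using (solve; _:=_; _:+_; _:*_)
  open import Relation.Binary.Reasoning.Setoid setoid

  Σ₁ : ℕ → (ℕ → Carrier) → Carrier
  Σ₁ = sum1 K

  Σ₁-cong : ∀ m {f g : ℕ → Carrier} → (∀ {k} → 1 ≤ k → k ≤ m → f k ≈ g k) → Σ₁ m f ≈ Σ₁ m g
  Σ₁-cong zero    f≈g = refl
  Σ₁-cong (suc m) f≈g = +-cong (Σ₁-cong m (λ 1≤k k≤m → f≈g 1≤k (ℕₚ.m≤n⇒m≤1+n k≤m))) (f≈g (s≤s z≤n) ℕₚ.≤-refl)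

  Σ₁-zero : ∀ m {f : ℕ → Carrier} → (∀ {k} → 1 ≤ k → k ≤ m → f k ≈ 0#) → Σ₁ m f ≈ 0#
  Σ₁-zero m f≈0 = trans (Σ₁-cong m f≈0) (Σ₁-const0 m)
    where
    Σ₁-const0 : ∀ m → Σ₁ m (λ _ → 0#) ≈ 0#
    Σ₁-const0 zero    = refl
    Σ₁-const0 (suc m) = trans (+-identityʳ _) (Σ₁-const0 m)

  Σ₁-linear : ∀ m x y (f g : ℕ → Carrier) → x * Σ₁ m f + y * Σ₁ m g ≈ Σ₁ m (λ k → x * f k + y * g k)
  Σ₁-linear zero    x y f g = trans (+-cong (zeroʳ x) (zeroʳ y)) (+-identityʳ 0#)
  Σ₁-linear (suc m) x y f g = begin
    x * (Σ₁ m f + f (suc m)) + y * (Σ₁ m g + g (suc m))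
      ≈⟨ solve 6 (λ x y F G a b → x :* (F :+ a) :+ y :* (G :+ b) := (x :* F :+ y :* G) :+ (x :* a :+ y :* b))
               refl x y (Σ₁ m f) (Σ₁ m g) (f (suc m)) (g (suc m)) ⟩
    (x * Σ₁ m f + y * Σ₁ m g) + (x * f (suc m) + y * g (suc m))
      ≈⟨ +-congʳ (Σ₁-linear m x y f g) ⟩
    Σ₁ (suc m) (λ k → x * f k + y * g k) ∎

  abel-summation : ∀ p q (w c : ℕ → Carrier) m →
    Σ₁ m (λ k → (p * w (k ∸ 1) + q * w k) * c k) + p * w m * c (suc m) ≈
    Σ₁ m (λ k → w k * (q * c k + p * c (suc k))) + p * w 0 * c 1
  abel-summation p q w c zero    = refl
  abel-summation p q w c (suc m) = begin
    (S + (p * w m + q * w′) * c′) + p * w′ * c″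
      ≈⟨ solve 7 (λ p q S w w′ c′ c″ → (S :+ (p :* w :+ q :* w′) :* c′) :+ p :* w′ :* c″ :=
                                       (S :+ p :* w :* c′) :+ w′ :* (q :* c′ :+ p :* c″))
               refl p q S (w m) w′ c′ c″ ⟩
    (S + p * w m * c′) + w′ * (q * c′ + p * c″)
      ≈⟨ +-congʳ (abel-summation p q w c m) ⟩
    (T + p * w 0 * c 1) + w′ * (q * c′ + p * c″)
      ≈⟨ solve 3 (λ T x y → (T :+ x) :+ y := (T :+ y) :+ x) refl T (p * w 0 * c 1) _ ⟩
    (T + w′ * (q * c′ + p * c″)) + p * w 0 * c 1 ∎
    where
    S = Σ₁ m (λ k → (p * w (k ∸ 1) + q * w k) * c k)
    T = Σ₁ m (λ k → w k * (q * c k + p * c (suc k)))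
    w′ = w (suc m)
    c′ = c (suc m)
    c″ = c (suc (suc m))

  private
    *-zero-middle : ∀ p {w} c → w ≈ 0# → p * w * c ≈ 0#
    *-zero-middle p c w≈0 = trans (*-congʳ (trans (*-congˡ w≈0) (zeroʳ p))) (zeroˡ c)

  summation-by-parts : ∀ p q {w : ℕ → Carrier} (c : ℕ → Carrier) m → w 0 ≈ 0# → w m ≈ 0# →
    Σ₁ m (λ k → (p * w (k ∸ 1) + q * w k) * c k) ≈ Σ₁ m (λ k → w k * (q * c k + p * c (suc k)))
  summation-by-parts p q {w} c m w₀≈0 wₘ≈0 = begin
    Σ₁ m (λ k → (p * w (k ∸ 1) + q * w k) * c k)
      ≈⟨ +-identityʳ _ ⟨
    Σ₁ m (λ k → (p * w (k ∸ 1) + q * w k) * c k) + 0#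
      ≈⟨ +-congˡ (*-zero-middle p (c (suc m)) wₘ≈0) ⟨
    Σ₁ m (λ k → (p * w (k ∸ 1) + q * w k) * c k) + p * w m * c (suc m)
      ≈⟨ abel-summation p q w c m ⟩
    Σ₁ m (λ k → w k * (q * c k + p * c (suc k))) + p * w 0 * c 1
      ≈⟨ +-congˡ (*-zero-middle p (c 1) w₀≈0) ⟩
    Σ₁ m (λ k → w k * (q * c k + p * c (suc k))) + 0#
      ≈⟨ +-identityʳ _ ⟩
    Σ₁ m (λ k → w k * (q * c k + p * c (suc k))) ∎

  Σ₁-zero-except-last : ∀ m {w d : ℕ → Carrier} → (∀ {k} → 1 ≤ k → k ≤ m ∸ 1 → d k ≈ 0#) → w m ≈ 0# →
    Σ₁ m (λ k → w k * d k) ≈ 0#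
  Σ₁-zero-except-last zero    d≈0 wₘ≈0 = refl
  Σ₁-zero-except-last (suc m) d≈0 wₘ≈0 = trans
    (+-cong (Σ₁-zero m (λ 1≤k k≤m → trans (*-congˡ (d≈0 1≤k k≤m)) (zeroʳ _))) (trans (*-congʳ wₘ≈0) (zeroˡ _)))
    (+-identityʳ 0#)

module Recurrences {c ℓ : Level} (K : CommutativeRing c ℓ) where
  open CommutativeRing K
  open IntegerCoefficients K using (solve; _:=_; _:+_; _:*_; _:-_; :-_)

  Recurrence : Carrier → Carrier → (ℕ → Carrier) → Set ℓ
  Recurrence t d x = ∀ e → x (suc (suc e)) ≈ t * x (suc e) - d * x e

  Recurrence-neg : ∀ {t d x} → Recurrence t d x → Recurrence t d (λ e → - x e)
  Recurrence-neg {t} {d} {x} rec e = trans (-‿cong (rec e))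
    (solve 5 (λ t d x₂ x₁ x₀ → :- (t :* x₁ :- d :* x₀) := t :* (:- x₁) :- d :* (:- x₀))
      refl t d (x (suc (suc e))) (x (suc e)) (x e))

  recSeq-unique : ∀ {α β γ δ x₁ x₂} {x : ℕ → Carrier} → Recurrence (β + δ) (β * δ + α * γ) x →
    x₁ ≈ x 0 → x₂ ≈ x 1 → ∀ e → recSeq K α β γ δ x₁ x₂ (suc e) ≈ x e
  recSeq-unique {α} {β} {γ} {δ} {x₁} {x₂} {x} rec x₁≈ x₂≈ e = proj₁ (consecutive e)
    where
    consecutive : ∀ e → recSeq K α β γ δ x₁ x₂ (suc e) ≈ x e × recSeq K α β γ δ x₁ x₂ (suc (suc e)) ≈ x (suc e)
    consecutive zero    = x₁≈ , x₂≈
    consecutive (suc e) = let (now , next) = consecutive e in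
      next , trans (+-cong (*-congˡ next) (-‿cong (*-congˡ now))) (sym (rec e))

  module Matrix₂ (p q r s : Carrier) where

    apply : Carrier × Carrier → Carrier × Carrier
    apply v = p * proj₁ v + q * proj₂ v , r * proj₁ v + s * proj₂ v

    orbit : Carrier × Carrier → ℕ → Carrier × Carrier
    orbit v zero    = v
    orbit v (suc e) = apply (orbit v e)

    module _ {t d : Carrier} (t≈ : t ≈ p + s) (d≈ : d ≈ p * s - q * r) (v : Carrier × Carrier) where

      private
        characteristic : ∀ x₁ x₀ → t * x₁ - d * x₀ ≈ (p + s) * x₁ - (p * s - q * r) * x₀
        characteristic x₁ x₀ = +-cong (*-congʳ t≈) (-‿cong (*-congʳ d≈))

      orbit₁-recurrence : Recurrence t d (λ e → proj₁ (orbit v e))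
      orbit₁-recurrence e = sym (trans (characteristic _ _)
        (solve 6 (λ p q r s x y →
           (p :+ s) :* (p :* x :+ q :* y) :- (p :* s :- q :* r) :* x := p :* (p :* x :+ q :* y) :+ q :* (r :* x :+ s :* y))
          refl p q r s (proj₁ (orbit v e)) (proj₂ (orbit v e))))

      orbit₂-recurrence : Recurrence t d (λ e → proj₂ (orbit v e))
      orbit₂-recurrence e = sym (trans (characteristic _ _)
        (solve 6 (λ p q r s x y →
           (p :+ s) :* (r :* x :+ s :* y) :- (p :* s :- q :* r) :* y := r :* (p :* x :+ q :* y) :+ s :* (r :* x :+ s :* y))
          refl p q r s (proj₁ (orbit v e)) (proj₂ (orbit v e))))

module AdjacentRows {c ℓ : Level} (K : CommutativeRing c ℓ) where
  open CommutativeRing K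
  open IntegerCoefficients K using (solve; _:=_; _:+_; _:*_; _:-_; :-_)
  open Sums K using (Σ₁; Σ₁-cong; Σ₁-linear)

  adjRows : Carrier → Carrier → Tableau K → ℕ → ℕ → Carrier
  adjRows x y X i k = x * X i k + y * X (i ∸ 1) k

  adjRows-matMul : ∀ n x y (X Y : Tableau K) i j →
    adjRows x y (matMul K n X Y) i j ≈ Σ₁ n (λ k → adjRows x y X i k * Y k j)
  adjRows-matMul n x y X Y i j = trans (Σ₁-linear n x y _ _) (Σ₁-cong n (λ {k} _ _ →
    solve 5 (λ x y u v z → x :* (u :* z) :+ y :* (v :* z) := (x :* u :+ y :* v) :* z)
      refl x y (X i k) (X (i ∸ 1) k) (Y k j)))

  adjRows-combine : ∀ s t D Ā G B (X : Tableau K) i k →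
    adjRows (s * D + t * G) (s * Ā + t * B) X i k ≈ s * adjRows D Ā X i k + t * adjRows G B X i k
  adjRows-combine s t D Ā G B X i k =
    solve 8 (λ s t D Ā G B u v →
      (s :* D :+ t :* G) :* u :+ (s :* Ā :+ t :* B) :* v := s :* (D :* u :+ Ā :* v) :+ t :* (G :* u :+ B :* v))
      refl s t D Ā G B (X i k) (X (i ∸ 1) k)

  adjRows-solve : ∀ {d a b g d′ a′ b′ g′} (X : Tableau K) i j j′ →
    d′ ≈ d → a′ ≈ - a → b′ ≈ b → g′ ≈ g → adjRows d a X i j ≈ adjRows g b X i j′ →
    d′ * X i j ≈ (a′ * X (i ∸ 1) j + b′ * X (i ∸ 1) j′) + g′ * X i j′
  adjRows-solve {d} {a} {b} {g} {d′} {a′} {b′} {g′} X i j j′ d′≈ a′≈ b′≈ g′≈ rel = begin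
    d′ * x                           ≈⟨ *-congʳ d′≈ ⟩
    d * x                            ≈⟨ solve 4 (λ d a x y → d :* x := (d :* x :+ a :* y) :- a :* y) refl d a x y ⟩
    adjRows d a X i j - a * y        ≈⟨ +-congʳ rel ⟩
    adjRows g b X i j′ - a * y       ≈⟨ solve 6 (λ g b a z t y → (g :* z :+ b :* t) :- a :* y := ((:- a) :* y :+ b :* t) :+ g :* z)
                                           refl g b a z t y ⟩
    (- a * y + b * t) + g * z        ≈⟨ sym (+-cong (+-cong (*-congʳ a′≈) (*-congʳ b′≈)) (*-congʳ g′≈)) ⟩
    (a′ * y + b′ * t) + g′ * z       ∎
    where
    open import Relation.Binary.Reasoning.Setoid setoid
    x = X i j
    y = X (i ∸ 1) j
    z = X i j′
    t = X (i ∸ 1) j′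

module TableauPowers {c ℓ : Level} (K : CommutativeRing c ℓ) where
  open CommutativeRing K

  module Powers (α β γ δ : Carrier) (n : ℕ) (a : Tableau K)
    (recurrence : ∀ i j → 1 ≤ i → 1 ≤ j → δ * a i j ≈ (α * a (i ∸ 1) j + β * a (i ∸ 1) (j ∸ 1)) + γ * a i (j ∸ 1))
    (left-boundary : ∀ i → 1 ≤ i → i ≤ n ∸ 1 → β * a i 0 + γ * a (suc i) 0 ≈ 0#)
    (right-boundary : ∀ i → 1 ≤ i → i ≤ n ∸ 1 → δ * a (suc i) (suc n) - α * a i (suc n) ≈ 0#)
    where

    open import Algebra.Properties.Ring ring using (-‿distribˡ-*)
    open IntegerCoefficients K using (solve; _:=_; _:+_; _:*_; _:-_; :-_)
    open Sums K
    open AdjacentRows K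

    private
      pred-≤ : ∀ {i m} → suc i ≤ m → i ≤ m ∸ 1
      pred-≤ {m = suc m} = s≤s⁻¹

    recurrence-adjRows : ∀ {i j} → 1 ≤ i → 1 ≤ j → adjRows δ (- α) a i j ≈ adjRows γ β a i (j ∸ 1)
    recurrence-adjRows {i} {j} 1≤i 1≤j = trans (+-congʳ (recurrence i j 1≤i 1≤j))
      (solve 6 (λ α β γ p q r → ((α :* p :+ β :* q) :+ γ :* r) :+ (:- α) :* p := γ :* r :+ β :* q)
        refl α β γ (a (i ∸ 1) j) (a (i ∸ 1) (j ∸ 1)) (a i (j ∸ 1)))

    column-shift : ∀ k j → (- α) * a k (suc j) + δ * a (suc k) (suc j) ≈ β * a k j + γ * a (suc k) j
    column-shift k j = trans (+-comm _ _) (trans (recurrence-adjRows (s≤s z≤n) (s≤s z≤n)) (+-comm _ _))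

    last-column-boundary : ∀ {m} → 1 ≤ m → m ≤ n ∸ 1 → β * a m n + γ * a (suc m) n ≈ 0#
    last-column-boundary {m} 1≤m m≤n-1 = begin
      β * a m n + γ * a (suc m) n               ≈⟨ +-comm _ _ ⟩
      adjRows γ β a (suc m) n                   ≈⟨ recurrence-adjRows (s≤s z≤n) (s≤s z≤n) ⟨
      δ * a (suc m) (suc n) + - α * a m (suc n) ≈⟨ +-congˡ (-‿distribˡ-* α _) ⟨
      δ * a (suc m) (suc n) - α * a m (suc n)   ≈⟨ right-boundary m 1≤m m≤n-1 ⟩
      0#                                        ∎
      where open import Relation.Binary.Reasoning.Setoid setoid

    -- R^e has no column 0; the entries of X there are junk and are read as zero.
    lower : Tableau K → Carrier → Carrier → ℕ → ℕ → Carrier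
    lower X G B i zero    = 0#
    lower X G B i (suc k) = adjRows G B X i (suc k)

    lower-pos : ∀ X G B i {k} → 1 ≤ k → lower X G B i k ≈ adjRows G B X i k
    lower-pos X G B i (s≤s z≤n) = refl

    record Relation (X : Tableau K) (D Ā G B : Carrier) : Set ℓ where
      field
        shift : ∀ {i k} → 2 ≤ i → i ≤ n → 1 ≤ k → k ≤ n → adjRows D Ā X i k ≈ lower X G B i (k ∸ 1)
        edge  : ∀ {i} → 2 ≤ i → i ≤ n → adjRows G B X i n ≈ 0#

    relation-base : Relation a δ (- α) γ β
    relation-base = record { shift = shift ; edge = edge }
      where
      shift : ∀ {i k} → 2 ≤ i → i ≤ n → 1 ≤ k → k ≤ n → adjRows δ (- α) a i k ≈ lower a γ β i (k ∸ 1)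
      shift {k = suc zero}    (s≤s (s≤s z≤n)) i≤n _ _ = trans (recurrence-adjRows (s≤s z≤n) (s≤s z≤n))
        (trans (+-comm _ _) (left-boundary _ (s≤s z≤n) (pred-≤ i≤n)))
      shift {k = suc (suc k)} (s≤s (s≤s z≤n)) _   _ _ = recurrence-adjRows (s≤s z≤n) (s≤s z≤n)

      edge : ∀ {i} → 2 ≤ i → i ≤ n → adjRows γ β a i n ≈ 0#
      edge (s≤s (s≤s z≤n)) i≤n = trans (+-comm _ _) (last-column-boundary (s≤s z≤n) (pred-≤ i≤n))

    relation-step : ∀ {X D Ā G B} → Relation X D Ā G B →
      Relation (matMul K n X a) (δ * D + (- α) * G) (δ * Ā + (- α) * B) (γ * D + β * G) (γ * Ā + β * B)
    relation-step {X} {D} {Ā} {G} {B} rel = record { shift = shift′ ; edge = edge′ }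
      where
      open Relation rel

      w : ℕ → ℕ → Carrier
      w = lower X G B

      wₙ≈0 : ∀ {i} → 2 ≤ i → i ≤ n → w i n ≈ 0#
      wₙ≈0 2≤i i≤n = trans (lower-pos X G B _ (ℕₚ.≤-trans (ℕₚ.≤-trans (s≤s z≤n) 2≤i) i≤n)) (edge 2≤i i≤n)

      -- Summing by parts moves the column shift of the relation for X onto the rows of R.
      combined : ∀ s t {i} → 2 ≤ i → i ≤ n → ∀ j →
        adjRows (s * D + t * G) (s * Ā + t * B) (matMul K n X a) i j ≈ Σ₁ n (λ k → w i k * (t * a k j + s * a (suc k) j))
      combined s t {i} 2≤i i≤n j = begin
        adjRows (s * D + t * G) (s * Ā + t * B) (matMul K n X a) i j
          ≈⟨ adjRows-matMul n _ _ X a i j ⟩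
        Σ₁ n (λ k → adjRows (s * D + t * G) (s * Ā + t * B) X i k * a k j)
          ≈⟨ Σ₁-cong n (λ 1≤k k≤n → *-congʳ (trans (adjRows-combine s t D Ā G B X i _)
               (+-cong (*-congˡ (shift 2≤i i≤n 1≤k k≤n)) (*-congˡ (sym (lower-pos X G B i 1≤k)))))) ⟩
        Σ₁ n (λ k → (s * w i (k ∸ 1) + t * w i k) * a k j)
          ≈⟨ summation-by-parts s t (λ k → a k j) n refl (wₙ≈0 2≤i i≤n) ⟩
        Σ₁ n (λ k → w i k * (t * a k j + s * a (suc k) j)) ∎
        where open import Relation.Binary.Reasoning.Setoid setoid

      shift′ : ∀ {i k} → 2 ≤ i → i ≤ n → 1 ≤ k → k ≤ n →
        adjRows (δ * D + (- α) * G) (δ * Ā + (- α) * B) (matMul K n X a) i k ≈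
        lower (matMul K n X a) (γ * D + β * G) (γ * Ā + β * B) i (k ∸ 1)
      shift′ {k = suc zero} 2≤i i≤n _ _ = trans (combined δ (- α) 2≤i i≤n 1)
        (Σ₁-zero-except-last n (λ 1≤m m≤n-1 → trans (column-shift _ 0) (left-boundary _ 1≤m m≤n-1)) (wₙ≈0 2≤i i≤n))
      shift′ {k = suc (suc k)} 2≤i i≤n _ _ = trans (combined δ (- α) 2≤i i≤n (suc (suc k)))
        (trans (Σ₁-cong n (λ _ _ → *-congˡ (column-shift _ (suc k)))) (sym (combined γ β 2≤i i≤n (suc k))))

      edge′ : ∀ {i} → 2 ≤ i → i ≤ n → adjRows (γ * D + β * G) (γ * Ā + β * B) (matMul K n X a) i n ≈ 0#
      edge′ 2≤i i≤n = trans (combined γ β 2≤i i≤n n) (Σ₁-zero-except-last n last-column-boundary (wₙ≈0 2≤i i≤n))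

    open Recurrences K
    open Matrix₂ δ (- α) γ β
    open import Algebra.Properties.Ring ring using (-‿involutive)

    Dₑ Āₑ Gₑ Bₑ : ℕ → Carrier
    Dₑ e = proj₁ (orbit (δ , γ) e)
    Gₑ e = proj₂ (orbit (δ , γ) e)
    Āₑ e = proj₁ (orbit (- α , β) e)
    Bₑ e = proj₂ (orbit (- α , β) e)

    relation : ∀ e → Relation (matPow K n a (suc e)) (Dₑ e) (Āₑ e) (Gₑ e) (Bₑ e)
    relation zero    = relation-base
    relation (suc e) = relation-step (relation e)

    private
      trace : β + δ ≈ δ + β
      trace = +-comm β δ

      det : β * δ + α * γ ≈ δ * β - (- α) * γ
      det = solve 4 (λ α β γ δ → β :* δ :+ α :* γ := δ :* β :- (:- α) :* γ) refl α β γ δ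

    δ-coefficients : ∀ e → recSeq K α β γ δ δ (δ * δ - α * γ) (suc e) ≈ Dₑ e
    δ-coefficients = recSeq-unique (orbit₁-recurrence trace det (δ , γ)) refl (+-congˡ (-‿distribˡ-* α γ))

    α-coefficients : ∀ e → recSeq K α β γ δ α (α * (δ + β)) (suc e) ≈ - Āₑ e
    α-coefficients = recSeq-unique (Recurrence-neg (orbit₁-recurrence trace det (- α , β))) (sym (-‿involutive α))
      (solve 3 (λ α β δ → α :* (δ :+ β) := :- (δ :* (:- α) :+ (:- α) :* β)) refl α β δ)

    β-coefficients : ∀ e → recSeq K α β γ δ β (β * β - α * γ) (suc e) ≈ Bₑ e
    β-coefficients = recSeq-unique (orbit₂-recurrence trace det (- α , β)) refl
      (solve 3 (λ α β γ → β :* β :- α :* γ := γ :* (:- α) :+ β :* β) refl α β γ)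

    γ-coefficients : ∀ e → recSeq K α β γ δ γ (γ * (β + δ)) (suc e) ≈ Gₑ e
    γ-coefficients = recSeq-unique (orbit₂-recurrence trace det (δ , γ)) refl
      (solve 3 (λ β γ δ → γ :* (β :+ δ) := γ :* δ :+ β :* γ) refl β γ δ)

theorem2p1 : {c ℓ : Level} (K : CommutativeRing c ℓ) → IsCharZeroField K →
    let open CommutativeRing K in
    (α β γ δ : Carrier) (n : ℕ) → 1 ≤ n → (a : Tableau K) →
    (∀ i j → 1 ≤ i → 1 ≤ j → δ * a i j ≈ (α * a (i ∸ 1) j + β * a (i ∸ 1) (j ∸ 1)) + γ * a i (j ∸ 1)) →
    (∀ i → 1 ≤ i → i ≤ n ∸ 1 → β * a i 0 + γ * a (suc i) 0 ≈ 0#) →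
    (∀ i → 1 ≤ i → i ≤ n ∸ 1 → δ * a (suc i) (suc n) - α * a i (suc n) ≈ 0#) →
    let δs = recSeq K α β γ δ δ (δ * δ - α * γ)
        αs = recSeq K α β γ δ α (α * (δ + β))
        βs = recSeq K α β γ δ β (β * β - α * γ)
        γs = recSeq K α β γ δ γ (γ * (β + δ))
        P = matPow K n a
    in
    ∀ e i j → 1 ≤ e → 2 ≤ i → i ≤ n → 2 ≤ j → j ≤ n →
      δs e * P e i j ≈ (αs e * P e (i ∸ 1) j + βs e * P e (i ∸ 1) (j ∸ 1)) + γs e * P e i (j ∸ 1)
theorem2p1 K _ α β γ δ n _ a recurrence left-boundary right-boundary
           (suc e) i j@(suc (suc _)) (s≤s z≤n) 2≤i i≤n (s≤s (s≤s z≤n)) j≤n =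
  adjRows-solve (matPow K n a (suc e)) i j (j ∸ 1)
    (δ-coefficients e) (α-coefficients e) (β-coefficients e) (γ-coefficients e)
    (Relation.shift (relation e) 2≤i i≤n (s≤s z≤n) j≤n)
  where
  open TableauPowers.Powers K α β γ δ n a recurrence left-boundary right-boundary
  open AdjacentRows K using (adjRows-solve)
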